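{- If $G$ is a finite graph that is a disjoint union of paths, then $G$ is determined up to isomorphism by its number of vertices $|G|$ and its matching-generating polynomial $M_G(t)$: if $G,H$ are disjoint unions of paths with $|G|=|H|$ and $M_G(t)=M_H(t)$, then $G\cong H$.
   Context: For a graph $G$, the matching-generating polynomial is $M_G(t)=\sum_S t^{|S|}$ over all matchings $S$ (sets of pairwise disjoint edges) of $G$. A path here may have a single vertex. -}

module Defs where

open import Data.Nat using (ℕ; zero; suc; _≡ᵇ_; _<ᵇ_; _≤_)
open import Data.Bool using (Bool; true; false; _∨_; _∧_; not)
open import Data.Bool.Properties using (∨-comm)
open import Data.Fin using (Fin; toℕ; splitAt)
open import Data.Sum using (_⊎_; inj₁; inj₂)
open import Data.Product using (_×_; _,_; ∃)
open import Data.List using (List; []; _∷_; map; _++_; concatMap; filterᵇ; allFin; length; foldr)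
open import Data.List.Relation.Unary.All using (All)
open import Function.Bundles using (_↔_; Inverse)
open import Relation.Binary.PropositionalEquality using (_≡_; refl)

record Graph : Set where
  field
    n      : ℕ
    adj    : Fin n → Fin n → Bool
    sym    : ∀ i j → adj i j ≡ adj j i
    irrefl : ∀ i → adj i i ≡ false
open Graph public

∣_∣ᵥ : Graph → ℕ
∣ G ∣ᵥ = n G

_≅_ : Graph → Graph → Set
G ≅ H = ∃ λ (f : Fin (n G) ↔ Fin (n H)) →
          ∀ i j → adj G i j ≡ adj H (Inverse.to f i) (Inverse.to f j)

private
  suc≢ᵇ : ∀ m → (suc m ≡ᵇ m) ≡ false
  suc≢ᵇ zero    = refl
  suc≢ᵇ (suc m) = suc≢ᵇ m

pathAdj : ∀ {k} → Fin k → Fin k → Bool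
pathAdj i j = (suc (toℕ i) ≡ᵇ toℕ j) ∨ (suc (toℕ j) ≡ᵇ toℕ i)

pathAdj-irr : ∀ {k} (i : Fin k) → pathAdj i i ≡ false
pathAdj-irr i rewrite suc≢ᵇ (toℕ i) = refl

P : ℕ → Graph
P k = record
  { n = k
  ; adj = pathAdj
  ; sym = λ i j → ∨-comm (suc (toℕ i) ≡ᵇ toℕ j) (suc (toℕ j) ≡ᵇ toℕ i)
  ; irrefl = pathAdj-irr
  }

module _ (G H : Graph) where
  private
    uadj : Fin (n G) ⊎ Fin (n H) → Fin (n G) ⊎ Fin (n H) → Bool
    uadj (inj₁ a) (inj₁ b) = adj G a b
    uadj (inj₂ a) (inj₂ b) = adj H a b
    uadj (inj₁ _) (inj₂ _) = false
    uadj (inj₂ _) (inj₁ _) = false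

    uadj-sym : ∀ x y → uadj x y ≡ uadj y x
    uadj-sym (inj₁ a) (inj₁ b) = sym G a b
    uadj-sym (inj₂ a) (inj₂ b) = sym H a b
    uadj-sym (inj₁ _) (inj₂ _) = refl
    uadj-sym (inj₂ _) (inj₁ _) = refl

    uadj-irr : ∀ x → uadj x x ≡ false
    uadj-irr (inj₁ a) = irrefl G a
    uadj-irr (inj₂ a) = irrefl H a

  _⊕_ : Graph
  _⊕_ = record
    { n = n G Data.Nat.+ n H
    ; adj = λ i j → uadj (splitAt (n G) i) (splitAt (n G) j)
    ; sym = λ i j → uadj-sym (splitAt (n G) i) (splitAt (n G) j)
    ; irrefl = λ i → uadj-irr (splitAt (n G) i)
    }

K₀ : Graph
K₀ = record { n = 0 ; adj = λ () ; sym = λ () ; irrefl = λ () }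

pathUnion : List ℕ → Graph
pathUnion ℓs = foldr _⊕_ K₀ (map P ℓs)

IsPathUnion : Graph → Set
IsPathUnion G = ∃ λ (ℓs : List ℕ) → All (λ ℓ → 1 ≤ ℓ) ℓs × (G ≅ pathUnion ℓs)

edges : (G : Graph) → List (Fin (n G) × Fin (n G))
edges G = concatMap (λ i → map (i ,_)
            (filterᵇ (λ j → (toℕ i <ᵇ toℕ j) ∧ adj G i j) (allFin (n G))))
          (allFin (n G))

subsets : {A : Set} → List A → List (List A)
subsets []       = [] ∷ []
subsets (x ∷ xs) = map (x ∷_) (subsets xs) ++ subsets xs

_=ᶠ_ : ∀ {k} → Fin k → Fin k → Bool
i =ᶠ j = toℕ i ≡ᵇ toℕ j

disjointEdges : ∀ {k} → Fin k × Fin k → Fin k × Fin k → Bool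
disjointEdges (a , b) (c , d) =
  not ((a =ᶠ c) ∨ (a =ᶠ d) ∨ (b =ᶠ c) ∨ (b =ᶠ d))

allᵇ : {A : Set} → (A → Bool) → List A → Bool
allᵇ p []       = true
allᵇ p (x ∷ xs) = p x ∧ allᵇ p xs

isMatching : ∀ {k} → List (Fin k × Fin k) → Bool
isMatching []       = true
isMatching (e ∷ es) = allᵇ (disjointEdges e) es ∧ isMatching es

-- Coefficient of t^k in M_G(t): the number of matchings of G with exactly k edges.
matchingCoeff : (G : Graph) → ℕ → ℕ
matchingCoeff G k =
  length (filterᵇ (λ S → (length S ≡ᵇ k) ∧ isMatching S) (subsets (edges G)))

-- Equality of matching-generating polynomials M_G(t) = M_H(t)
-- (polynomials with ℕ coefficients are equal iff all coefficients agree).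
_≡ᴹ_ : Graph → Graph → Set
G ≡ᴹ H = ∀ k → matchingCoeff G k ≡ matchingCoeff H k

-- Let W(t, y) = Σ_S t^|S| y^(|E| - |S|) be the homogenised matching polynomial.  It is determined
-- by M_G, multiplicative over disjoint unions, and on the path with r edges it satisfies
-- W_{r+2} = y W_{r+1} + t y W_r.  At t = -q, y = (1 + q)² this gives (1 - q²) W_r = (1 + q)^r (1 - q^(r+2)),
-- so a disjoint union of paths with ℓ₁, …, ℓ_c vertices has (1 - q²)^c W = (1 + q)^|E| ∏ᵢ (1 - q^(ℓᵢ+1)).
-- The numbers of vertices and of edges (the linear coefficient of M_G) fix c and |E|, so M_G = M_H
-- makes the products ∏ᵢ (1 - q^(ℓᵢ+1)) agree at every integer q ≥ 2.  These values determine the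
-- exponents: if the least exponent m occurs s times, the product is 1 - s q^m modulo q^(m+1), and at
-- q = s + 1 this shows that both sides have the same least exponent with the same multiplicity;
-- cancelling the common factor and repeating, the multisets of path lengths coincide.

module Submission where

import Algebra.Properties.CommutativeSemigroup
open import Algebra.Bundles using (CommutativeMonoid)
open import Data.Bool using (Bool; true; false; _∧_; _∨_; not; if_then_else_; T; T?)
open import Data.Bool.Properties using (∧-assoc; ∧-identityʳ; ∧-zeroʳ; ∧-commutativeMonoid; ∨-assoc; ∨-comm)
open import Data.Empty using (⊥-elim)
open import Data.Fin as Fin using (Fin; toℕ; _↑ˡ_; _↑ʳ_; splitAt; join)
import Data.Fin.Properties as Fin
open import Data.Integer as ℤ using (ℤ; +_; 0ℤ; 1ℤ; _+_; _*_; _-_; -_; _^_; ∣_∣)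
import Data.Integer.Properties as ℤ
open import Data.Integer.Tactic.RingSolver using (solve-∀)
open import Data.List
  using (List; []; _∷_; [_]; map; length; filterᵇ; _++_; concatMap; allFin; tabulate; foldr; cartesianProduct)
import Data.List.Properties as List
open import Data.List.Membership.Propositional using (_∈_)
import Data.List.Membership.Propositional.Properties as ∈
open import Data.List.Membership.Propositional.Properties.WithK using (unique∧set⇒bag)
open import Data.List.Relation.Binary.BagAndSetEquality using (∼bag⇒↭)
open import Data.List.Relation.Binary.Permutation.Propositional as ↭ using (_↭_)
import Data.List.Relation.Binary.Permutation.Propositional.Properties as ↭
open import Data.List.Relation.Unary.All as All using (All; []; _∷_)
import Data.List.Relation.Unary.All.Properties as All
open import Data.List.Relation.Unary.AllPairs using (AllPairs; []; _∷_)
open import Data.List.Relation.Unary.Linked.Properties using (Linked⇒AllPairs)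
open import Data.List.Relation.Unary.Unique.Propositional using (Unique)
import Data.List.Relation.Unary.Unique.Propositional.Properties as Unique
open import Data.Nat as ℕ using (ℕ; zero; suc; _≤_; _<_; s≤s; z≤n; _≡ᵇ_; _<ᵇ_; pred)
import Data.Nat.Properties as ℕ
open import Data.Nat.Divisibility using (divides; ∣⇒≤)
open import Data.Nat.ListAction using (sum)
open import Data.List.Sort ℕ.≤-decTotalOrder using (sort; sort-↭; sort-↗)
open import Data.Product using (Σ; _×_; _,_; proj₂; uncurry)
open import Data.Sum using (_⊎_; inj₁; inj₂)
open import Data.Sum.Algebra using (⊎-comm; ⊎-assoc; ⊎-cong)
open import Data.Unit using (tt)
open import Function using (_∘_; Injective; mk⇔; case_of_)
open import Function.Bundles using (_↔_; Inverse; Injection)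
open import Function.Properties.Inverse using (↔-refl; ↔-sym; ↔-trans; ↔⇒↣)
open import Relation.Binary using (tri<; tri≈; tri>)
open import Relation.Binary.Bundles using (Setoid)
open import Relation.Binary.PropositionalEquality hiding ([_])
open import Relation.Nullary using (¬_)

open import Defs renaming (sym to adj-sym)

private variable
  A B : Set

≡true⇒T : ∀ {b} → b ≡ true → T b
≡true⇒T refl = _

T⇒≡true : ∀ {b} → T b → b ≡ true
T⇒≡true {true} _ = refl

∧-true₁ : ∀ {a b} → (a ∧ b) ≡ true → a ≡ true
∧-true₁ {true} _ = refl

∧-true₂ : ∀ {a b} → (a ∧ b) ≡ true → b ≡ true
∧-true₂ {true} b≡true = b≡true

Bool-ext : ∀ {a b : Bool} → (a ≡ true → b ≡ true) → (b ≡ true → a ≡ true) → a ≡ b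
Bool-ext {true}  {true}  _ _ = refl
Bool-ext {false} {false} _ _ = refl
Bool-ext {true}  {false} a⇒b _ = sym (a⇒b refl)
Bool-ext {false} {true}  _ b⇒a = b⇒a refl

module ∧ = Algebra.Properties.CommutativeSemigroup (CommutativeMonoid.commutativeSemigroup ∧-commutativeMonoid)
module + = Algebra.Properties.CommutativeSemigroup ℕ.+-commutativeSemigroup

allᵇ-cong : ∀ {p q : A → Bool} xs → (∀ x → p x ≡ q x) → allᵇ p xs ≡ allᵇ q xs
allᵇ-cong []       p≗q = refl
allᵇ-cong (x ∷ xs) p≗q = cong₂ _∧_ (p≗q x) (allᵇ-cong xs p≗q)

allᵇ-++ : ∀ (p : A → Bool) xs ys → allᵇ p (xs ++ ys) ≡ allᵇ p xs ∧ allᵇ p ys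
allᵇ-++ p []       ys = refl
allᵇ-++ p (x ∷ xs) ys = trans (cong (p x ∧_) (allᵇ-++ p xs ys)) (sym (∧-assoc (p x) _ _))

allᵇ-true : ∀ {p : A → Bool} {xs} → All (λ x → p x ≡ true) xs → allᵇ p xs ≡ true
allᵇ-true []         = refl
allᵇ-true (px ∷ pxs) rewrite px = allᵇ-true pxs

allᵇ-↭ : ∀ (p : A → Bool) {xs ys} → xs ↭ ys → allᵇ p xs ≡ allᵇ p ys
allᵇ-↭ p ↭.refl          = refl
allᵇ-↭ p (↭.prep x xs↭ys) = cong (p x ∧_) (allᵇ-↭ p xs↭ys)
allᵇ-↭ p (↭.swap x y xs↭ys) =
  trans (∧.x∙yz≈y∙xz (p x) (p y) _) (cong (λ b → p y ∧ (p x ∧ b)) (allᵇ-↭ p xs↭ys))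
allᵇ-↭ p (↭.trans xs↭ys ys↭zs) = trans (allᵇ-↭ p xs↭ys) (allᵇ-↭ p ys↭zs)

pairwise : (A → A → Bool) → List A → Bool
pairwise d []       = true
pairwise d (x ∷ xs) = allᵇ (d x) xs ∧ pairwise d xs

pairwise-↭ : ∀ {d : A → A → Bool} → (∀ x y → d x y ≡ d y x) →
             ∀ {xs ys} → xs ↭ ys → pairwise d xs ≡ pairwise d ys
pairwise-↭ d-comm ↭.refl = refl
pairwise-↭ d-comm (↭.prep x xs↭ys) = cong₂ _∧_ (allᵇ-↭ _ xs↭ys) (pairwise-↭ d-comm xs↭ys)
pairwise-↭ {d = d} d-comm (↭.swap {xs} x y xs↭ys) =
  trans (∧.interchange (d x y) (allᵇ (d x) xs) (allᵇ (d y) xs) (pairwise d xs))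
        (cong₂ _∧_ (cong₂ _∧_ (d-comm x y) (allᵇ-↭ _ xs↭ys))
                   (cong₂ _∧_ (allᵇ-↭ _ xs↭ys) (pairwise-↭ d-comm xs↭ys)))
pairwise-↭ d-comm (↭.trans xs↭ys ys↭zs) = trans (pairwise-↭ d-comm xs↭ys) (pairwise-↭ d-comm ys↭zs)

pairwise-++ : ∀ {d : A → A → Bool} {P Q : A → Set} → (∀ {x y} → P x → Q y → d x y ≡ true) →
              ∀ {xs ys} → All P xs → All Q ys → pairwise d (xs ++ ys) ≡ pairwise d xs ∧ pairwise d ys
pairwise-++ d-PQ [] Qys = refl
pairwise-++ {d = d} d-PQ {x ∷ xs} {ys} (Px ∷ Pxs) Qys
  rewrite allᵇ-++ (d x) xs ys | allᵇ-true (All.map (d-PQ Px) Qys) | pairwise-++ d-PQ Pxs Qys =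
  trans (cong (_∧ _) (∧-identityʳ (allᵇ (d x) xs))) (sym (∧-assoc (allᵇ (d x) xs) (pairwise d xs) (pairwise d ys)))

allᵇ-map : ∀ (p : B → Bool) (f : A → B) xs → allᵇ p (map f xs) ≡ allᵇ (p ∘ f) xs
allᵇ-map p f []       = refl
allᵇ-map p f (x ∷ xs) = cong (p (f x) ∧_) (allᵇ-map p f xs)

pairwise-map : ∀ {d : A → A → Bool} {d′ : B → B → Bool} {f : A → B} →
               (∀ x y → d′ (f x) (f y) ≡ d x y) → ∀ xs → pairwise d′ (map f xs) ≡ pairwise d xs
pairwise-map         f-resp []       = refl
pairwise-map {f = f} f-resp (x ∷ xs) =
  cong₂ _∧_ (trans (allᵇ-map _ f xs) (allᵇ-cong xs (f-resp x))) (pairwise-map f-resp xs)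

subsets-map : ∀ (f : A → B) xs → subsets (map f xs) ≡ map (map f) (subsets xs)
subsets-map f []       = refl
subsets-map f (x ∷ xs) = begin
  map (f x ∷_) (subsets (map f xs)) ++ subsets (map f xs)
    ≡⟨ cong (λ Ss → map (f x ∷_) Ss ++ Ss) (subsets-map f xs) ⟩
  map (f x ∷_) (map (map f) (subsets xs)) ++ map (map f) (subsets xs)
    ≡⟨ cong (_++ _) (trans (sym (List.map-∘ (subsets xs))) (List.map-∘ (subsets xs))) ⟩
  map (map f) (map (x ∷_) (subsets xs)) ++ map (map f) (subsets xs)
    ≡⟨ List.map-++ (map f) (map (x ∷_) (subsets xs)) (subsets xs) ⟨
  map (map f) (subsets (x ∷ xs)) ∎
  where open ≡-Reasoning

filterᵇ-cong : ∀ {p q : A → Bool} xs → (∀ x → p x ≡ q x) → filterᵇ p xs ≡ filterᵇ q xs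
filterᵇ-cong []       p≗q = refl
filterᵇ-cong {p = p} {q} (x ∷ xs) p≗q with p x | q x | p≗q x
... | true  | true  | _ = cong (x ∷_) (filterᵇ-cong xs p≗q)
... | false | false | _ = filterᵇ-cong xs p≗q

filterᵇ-false : ∀ (p : A → Bool) xs → (∀ x → p x ≡ false) → filterᵇ p xs ≡ []
filterᵇ-false p []       p≗false = refl
filterᵇ-false p (x ∷ xs) p≗false with p x | p≗false x
... | false | _ = filterᵇ-false p xs p≗false

filterᵇ-map : ∀ (p : B → Bool) (f : A → B) xs → filterᵇ p (map f xs) ≡ map f (filterᵇ (p ∘ f) xs)
filterᵇ-map p f []       = refl
filterᵇ-map p f (x ∷ xs) with p (f x)
... | true  = cong (f x ∷_) (filterᵇ-map p f xs)
... | false = filterᵇ-map p f xs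

count : {A : Set} → (A → Bool) → List A → ℕ
count p xs = length (filterᵇ p xs)

count-++ : ∀ (p : A → Bool) xs ys → count p (xs ++ ys) ≡ count p xs ℕ.+ count p ys
count-++ p xs ys = trans (cong length (List.filter-++ (T? ∘ p) xs ys)) (List.length-++ (filterᵇ p xs))

count-cong : ∀ {p q : A → Bool} xs → (∀ x → p x ≡ q x) → count p xs ≡ count q xs
count-cong xs p≗q = cong length (filterᵇ-cong xs p≗q)

count-false : ∀ (p : A → Bool) xs → (∀ x → p x ≡ false) → count p xs ≡ 0
count-false p xs p≗false = cong length (filterᵇ-false p xs p≗false)

count-map : ∀ (p : B → Bool) (f : A → B) xs → count p (map f xs) ≡ count (p ∘ f) xs
count-map p f xs = trans (cong length (filterᵇ-map p f xs)) (List.length-map f (filterᵇ (p ∘ f) xs))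

count-subsets-∷ : ∀ (p : List A → Bool) x xs →
  count p (subsets (x ∷ xs)) ≡ count (p ∘ (x ∷_)) (subsets xs) ℕ.+ count p (subsets xs)
count-subsets-∷ p x xs =
  trans (count-++ p (map (x ∷_) (subsets xs)) (subsets xs))
        (cong (ℕ._+ _) (count-map p (x ∷_) (subsets xs)))

count-subsets-↭ : ∀ {xs ys} → xs ↭ ys → ∀ (p : List A → Bool) →
  (∀ {S S′} → S ↭ S′ → p S ≡ p S′) → count p (subsets xs) ≡ count p (subsets ys)
count-subsets-↭ ↭.refl p p-↭ = refl
count-subsets-↭ (↭.prep {xs} {ys} x xs↭ys) p p-↭ = begin
  count p (subsets (x ∷ xs))
    ≡⟨ count-subsets-∷ p x xs ⟩
  count (p ∘ (x ∷_)) (subsets xs) ℕ.+ count p (subsets xs)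
    ≡⟨ cong₂ ℕ._+_ (count-subsets-↭ xs↭ys _ (p-↭ ∘ ↭.prep x)) (count-subsets-↭ xs↭ys p p-↭) ⟩
  count (p ∘ (x ∷_)) (subsets ys) ℕ.+ count p (subsets ys)
    ≡⟨ count-subsets-∷ p x ys ⟨
  count p (subsets (x ∷ ys)) ∎
  where open ≡-Reasoning
count-subsets-↭ (↭.swap {xs} {ys} x y xs↭ys) p p-↭ = begin
  count p (subsets (x ∷ y ∷ xs))
    ≡⟨ expand x y xs ⟩
  (#[ p ∘ (x ∷_) ∘ (y ∷_) ] xs ℕ.+ #[ p ∘ (x ∷_) ] xs) ℕ.+ (#[ p ∘ (y ∷_) ] xs ℕ.+ #[ p ] xs)
    ≡⟨ cong₂ ℕ._+_
         (cong₂ ℕ._+_ (trans (count-cong (subsets xs) (λ _ → p-↭ (↭.swap x y ↭.refl)))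
                             (count-subsets-↭ xs↭ys _ (p-↭ ∘ ↭.prep y ∘ ↭.prep x)))
                      (count-subsets-↭ xs↭ys _ (p-↭ ∘ ↭.prep x)))
         (cong₂ ℕ._+_ (count-subsets-↭ xs↭ys _ (p-↭ ∘ ↭.prep y)) (count-subsets-↭ xs↭ys p p-↭)) ⟩
  (#[ p ∘ (y ∷_) ∘ (x ∷_) ] ys ℕ.+ #[ p ∘ (x ∷_) ] ys) ℕ.+ (#[ p ∘ (y ∷_) ] ys ℕ.+ #[ p ] ys)
    ≡⟨ +.interchange (#[ p ∘ (y ∷_) ∘ (x ∷_) ] ys) (#[ p ∘ (x ∷_) ] ys) (#[ p ∘ (y ∷_) ] ys) (#[ p ] ys) ⟩
  (#[ p ∘ (y ∷_) ∘ (x ∷_) ] ys ℕ.+ #[ p ∘ (y ∷_) ] ys) ℕ.+ (#[ p ∘ (x ∷_) ] ys ℕ.+ #[ p ] ys)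
    ≡⟨ expand y x ys ⟨
  count p (subsets (y ∷ x ∷ ys)) ∎
  where
  open ≡-Reasoning
  #[_]_ : (List A → Bool) → List A → ℕ
  #[ q ] zs = count q (subsets zs)
  expand : ∀ u v zs → #[ p ] (u ∷ v ∷ zs) ≡
    (#[ p ∘ (u ∷_) ∘ (v ∷_) ] zs ℕ.+ #[ p ∘ (u ∷_) ] zs) ℕ.+ (#[ p ∘ (v ∷_) ] zs ℕ.+ #[ p ] zs)
  expand u v zs = trans (count-subsets-∷ p u (v ∷ zs))
                        (cong₂ ℕ._+_ (count-subsets-∷ _ v zs) (count-subsets-∷ p v zs))
count-subsets-↭ (↭.trans xs↭ys ys↭zs) p p-↭ =
  trans (count-subsets-↭ xs↭ys p p-↭) (count-subsets-↭ ys↭zs p p-↭)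

subsetCount : {A : Set} → (List A → Bool) → List A → ℕ → ℕ
subsetCount p E k = count (λ S → (length S ≡ᵇ k) ∧ p S) (subsets E)

subsetCount-∷-zero : ∀ p (e : A) E → subsetCount p (e ∷ E) 0 ≡ subsetCount p E 0
subsetCount-∷-zero p e E =
  trans (count-subsets-∷ _ e E) (cong (ℕ._+ subsetCount p E 0) (count-false _ (subsets E) (λ _ → refl)))

subsetCount-∷-suc : ∀ p (e : A) E k →
  subsetCount p (e ∷ E) (suc k) ≡ subsetCount (p ∘ (e ∷_)) E k ℕ.+ subsetCount p E (suc k)
subsetCount-∷-suc p e E k = count-subsets-∷ _ e E

subsetCount-beyond : ∀ p (E : List A) k → length E < k → subsetCount p E k ≡ 0
subsetCount-beyond p []      (suc k) _ = refl
subsetCount-beyond p (e ∷ E) (suc k) (s≤s |E|<k) = begin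
  subsetCount p (e ∷ E) (suc k)
    ≡⟨ subsetCount-∷-suc p e E k ⟩
  subsetCount (p ∘ (e ∷_)) E k ℕ.+ subsetCount p E (suc k)
    ≡⟨ cong₂ ℕ._+_ (subsetCount-beyond _ E k |E|<k) (subsetCount-beyond p E (suc k) (ℕ.m<n⇒m<1+n |E|<k)) ⟩
  0 ∎
  where open ≡-Reasoning

subsetCount-zero : ∀ p (E : List A) → subsetCount p E 0 ≡ (if p [] then 1 else 0)
subsetCount-zero p []      with p []
... | true  = refl
... | false = refl
subsetCount-zero p (e ∷ E) = trans (subsetCount-∷-zero p e E) (subsetCount-zero p E)

subsetCount-one : ∀ p (E : List A) → (∀ e → p [ e ] ≡ true) → subsetCount p E 1 ≡ length E
subsetCount-one p []      p-singleton = refl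
subsetCount-one p (e ∷ E) p-singleton =
  trans (subsetCount-∷-suc p e E 0)
        (cong₂ ℕ._+_ (trans (subsetCount-zero _ E) (cong (if_then 1 else 0) (p-singleton e)))
                     (subsetCount-one p E p-singleton))

module _ (t y : ℤ) where

  subsetWeight : {A : Set} → (List A → Bool) → List A → ℤ
  subsetWeight p []      = if p [] then 1ℤ else 0ℤ
  subsetWeight p (e ∷ E) = t * subsetWeight (p ∘ (e ∷_)) E + y * subsetWeight p E

  homogeneous : ℕ → (ℕ → ℕ) → ℤ
  homogeneous zero    a = + a 0
  homogeneous (suc d) a = y * homogeneous d a + t ^ suc d * + a (suc d)

  homogeneous-cong : ∀ d {a b} → (∀ k → a k ≡ b k) → homogeneous d a ≡ homogeneous d b
  homogeneous-cong zero    a≗b = cong +_ (a≗b 0)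
  homogeneous-cong (suc d) a≗b =
    cong₂ (λ u v → y * u + t ^ suc d * + v) (homogeneous-cong d a≗b) (a≗b (suc d))

  homogeneous-+ : ∀ d a b → homogeneous d (λ k → a k ℕ.+ b k) ≡ homogeneous d a + homogeneous d b
  homogeneous-+ zero    a b = ℤ.pos-+ (a 0) (b 0)
  homogeneous-+ (suc d) a b =
    trans (cong₂ (λ u v → y * u + t ^ suc d * v) (homogeneous-+ d a b) (ℤ.pos-+ (a (suc d)) (b (suc d))))
          (distrib y (homogeneous d a) (homogeneous d b) (t ^ suc d) (+ a (suc d)) (+ b (suc d)))
    where
    distrib : ∀ y u v w a b → y * (u + v) + w * (a + b) ≡ (y * u + w * a) + (y * v + w * b)
    distrib = solve-∀

  homogeneous-suc : ∀ d a → homogeneous (suc d) a ≡ + a 0 * y ^ suc d + t * homogeneous d (a ∘ suc)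
  homogeneous-suc zero    a = ring t y (+ a 0) (+ a 1)
    where
    ring : ∀ t y u v → y * u + t * 1ℤ * v ≡ u * (y * 1ℤ) + t * v
    ring = solve-∀
  homogeneous-suc (suc d) a =
    trans (cong (λ h → y * h + t ^ suc (suc d) * + a (suc (suc d))) (homogeneous-suc d a))
          (ring t y (+ a 0) (y ^ suc d) (homogeneous d (a ∘ suc)) (t ^ suc d) (+ a (suc (suc d))))
    where
    ring : ∀ t y a₀ Y H T z → y * (a₀ * Y + t * H) + t * T * z ≡ a₀ * (y * Y) + t * (y * H + T * z)
    ring = solve-∀

  subsetWeight-homogeneous : ∀ (p : List A → Bool) E →
    subsetWeight p E ≡ homogeneous (length E) (subsetCount p E)
  subsetWeight-homogeneous p []      with p []
  ... | true  = refl
  ... | false = refl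
  subsetWeight-homogeneous p (e ∷ E) = begin
    t * subsetWeight p′ E + y * subsetWeight p E
      ≡⟨ cong₂ (λ u v → t * u + y * v) (subsetWeight-homogeneous p′ E) (subsetWeight-homogeneous p E) ⟩
    t * homogeneous d c′ + y * homogeneous d c
      ≡⟨ cong (_+_ (t * homogeneous d c′)) y*homogeneous ⟩
    t * homogeneous d c′ + (+ c 0 * y ^ suc d + t * homogeneous d (c ∘ suc))
      ≡⟨ ring t (homogeneous d c′) (+ c 0 * y ^ suc d) (homogeneous d (c ∘ suc)) ⟩
    + c 0 * y ^ suc d + t * (homogeneous d c′ + homogeneous d (c ∘ suc))
      ≡⟨ cong₂ (λ u v → + u * y ^ suc d + t * v) (sym (subsetCount-∷-zero p e E))
               (trans (sym (homogeneous-+ d c′ (c ∘ suc)))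
                      (homogeneous-cong d (λ k → sym (subsetCount-∷-suc p e E k)))) ⟩
    + subsetCount p (e ∷ E) 0 * y ^ suc d + t * homogeneous d (subsetCount p (e ∷ E) ∘ suc)
      ≡⟨ homogeneous-suc d (subsetCount p (e ∷ E)) ⟨
    homogeneous (suc d) (subsetCount p (e ∷ E)) ∎
    where
    open ≡-Reasoning
    p′ = p ∘ (e ∷_)
    d = length E
    c = subsetCount p E
    c′ = subsetCount p′ E
    ring : ∀ t a b c → t * a + (b + t * c) ≡ b + t * (a + c)
    ring = solve-∀
    y*homogeneous : y * homogeneous d c ≡ + c 0 * y ^ suc d + t * homogeneous d (c ∘ suc)
    y*homogeneous = begin
      y * homogeneous d c                           ≡⟨ ℤ.+-identityʳ _ ⟨
      y * homogeneous d c + 0ℤ                      ≡⟨ cong (_+_ (y * homogeneous d c)) (ℤ.*-zeroʳ (t ^ suc d)) ⟨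
      y * homogeneous d c + t ^ suc d * 0ℤ          ≡⟨ cong (λ z → y * homogeneous d c + t ^ suc d * + z)
                                                          (subsetCount-beyond p E (suc d) ℕ.≤-refl) ⟨
      homogeneous (suc d) c                         ≡⟨ homogeneous-suc d c ⟩
      + c 0 * y ^ suc d + t * homogeneous d (c ∘ suc) ∎

  subsetWeight-cong : ∀ {P : A → Set} {p q : List A → Bool} {E} → All P E →
    (∀ S → All P S → p S ≡ q S) → subsetWeight p E ≡ subsetWeight q E
  subsetWeight-cong {p = p} [] p≗q rewrite p≗q [] [] = refl
  subsetWeight-cong (Pe ∷ PE) p≗q =
    cong₂ (λ u v → t * u + y * v) (subsetWeight-cong PE (λ S PS → p≗q (_ ∷ S) (Pe ∷ PS)))
                                  (subsetWeight-cong PE p≗q)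

  subsetWeight-≗ : ∀ {p q : List A → Bool} E → (∀ S → p S ≡ q S) → subsetWeight p E ≡ subsetWeight q E
  subsetWeight-≗ E p≗q = subsetWeight-cong (All.universal (λ _ → tt) E) (λ S _ → p≗q S)

  subsetWeight-false : ∀ {P : A → Set} {p : List A → Bool} {E} → All P E →
    (∀ S → All P S → p S ≡ false) → subsetWeight p E ≡ 0ℤ
  subsetWeight-false {p = p} [] p≗false rewrite p≗false [] [] = refl
  subsetWeight-false (Pe ∷ PE) p≗false
    rewrite subsetWeight-false PE (λ S PS → p≗false (_ ∷ S) (Pe ∷ PS)) | subsetWeight-false PE p≗false =
    ring t y
    where
    ring : ∀ t y → t * 0ℤ + y * 0ℤ ≡ 0ℤ
    ring = solve-∀

  subsetWeight-++ : ∀ {P Q : A → Set} {p r q : List A → Bool} {E₁ E₂} → All P E₁ → All Q E₂ →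
    (∀ S₁ S₂ → All P S₁ → All Q S₂ → p (S₁ ++ S₂) ≡ r S₁ ∧ q S₂) →
    subsetWeight p (E₁ ++ E₂) ≡ subsetWeight r E₁ * subsetWeight q E₂
  subsetWeight-++ {r = r} {q} {E₂ = E₂} [] QE₂ p-split with r [] | p-split []
  ... | true  | p≗q     = trans (subsetWeight-cong QE₂ (λ S QS → p≗q S [] QS)) (sym (ℤ.*-identityˡ _))
  ... | false | p≗false = trans (subsetWeight-false QE₂ (λ S QS → p≗false S [] QS))
                                (sym (ℤ.*-zeroˡ (subsetWeight q E₂)))
  subsetWeight-++ {r = r} {q} {e ∷ E₁} {E₂} (Pe ∷ PE₁) QE₂ p-split =
    trans (cong₂ (λ u v → t * u + y * v)
            (subsetWeight-++ PE₁ QE₂ (λ S₁ S₂ PS₁ QS₂ → p-split (e ∷ S₁) S₂ (Pe ∷ PS₁) QS₂))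
            (subsetWeight-++ PE₁ QE₂ p-split))
          (ring t y (subsetWeight (r ∘ (e ∷_)) E₁) (subsetWeight r E₁) (subsetWeight q E₂))
    where
    ring : ∀ t y a b x → t * (a * x) + y * (b * x) ≡ (t * a + y * b) * x
    ring = solve-∀

  subsetWeight-map : ∀ (p : List B → Bool) (f : A → B) E →
    subsetWeight p (map f E) ≡ subsetWeight (p ∘ map f) E
  subsetWeight-map p f []      = refl
  subsetWeight-map p f (e ∷ E) =
    cong₂ (λ u v → t * u + y * v) (subsetWeight-map _ f E) (subsetWeight-map p f E)

Edge : Set
Edge = ℕ × ℕ

disjointℕ : Edge → Edge → Bool
disjointℕ (a , b) (c , d) = not ((a ≡ᵇ c) ∨ (a ≡ᵇ d) ∨ (b ≡ᵇ c) ∨ (b ≡ᵇ d))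

isMatchingℕ : List Edge → Bool
isMatchingℕ = pairwise disjointℕ

toℕ² : ∀ {k} → Fin k × Fin k → Edge
toℕ² (a , b) = toℕ a , toℕ b

-- Ends read as natural numbers, so that edge lists of graphs of different orders can be compared.
edgesℕ : Graph → List Edge
edgesℕ G = map toℕ² (edges G)

isMatching-pairwise : ∀ {k} (S : List (Fin k × Fin k)) → isMatching S ≡ pairwise disjointEdges S
isMatching-pairwise []      = refl
isMatching-pairwise (e ∷ S) = cong (allᵇ (disjointEdges e) S ∧_) (isMatching-pairwise S)

isMatching-toℕ² : ∀ {k} (S : List (Fin k × Fin k)) → isMatching S ≡ isMatchingℕ (map toℕ² S)
isMatching-toℕ² S = trans (isMatching-pairwise S) (sym (pairwise-map (λ { (a , b) (c , d) → refl }) S))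

matchingCoeff-edgesℕ : ∀ G k → matchingCoeff G k ≡ subsetCount isMatchingℕ (edgesℕ G) k
matchingCoeff-edgesℕ G k = sym (begin
  count _ (subsets (map toℕ² (edges G)))       ≡⟨ cong (count _) (subsets-map toℕ² (edges G)) ⟩
  count _ (map (map toℕ²) (subsets (edges G))) ≡⟨ count-map _ (map toℕ²) (subsets (edges G)) ⟩
  count _ (subsets (edges G))                  ≡⟨ count-cong (subsets (edges G)) (λ S →
                                                    cong₂ _∧_ (cong (_≡ᵇ k) (List.length-map toℕ² S))
                                                              (sym (isMatching-toℕ² S))) ⟩
  matchingCoeff G k ∎)
  where open ≡-Reasoning

edgeCount : ∀ G → length (edgesℕ G) ≡ matchingCoeff G 1
edgeCount G = sym (trans (matchingCoeff-edgesℕ G 1) (subsetCount-one isMatchingℕ (edgesℕ G) (λ _ → refl)))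

module _ (t y : ℤ) where

  matchingWeightᴱ : List Edge → ℤ
  matchingWeightᴱ = subsetWeight t y isMatchingℕ

  -- y ^ ∣E∣ * M_G (t / y), the homogenised matching polynomial
  matchingWeight : Graph → ℤ
  matchingWeight G = matchingWeightᴱ (edgesℕ G)

  matchingWeight-homogeneous : ∀ G → matchingWeight G ≡ homogeneous t y (matchingCoeff G 1) (matchingCoeff G)
  matchingWeight-homogeneous G = begin
    matchingWeight G
      ≡⟨ subsetWeight-homogeneous t y isMatchingℕ (edgesℕ G) ⟩
    homogeneous t y (length (edgesℕ G)) (subsetCount isMatchingℕ (edgesℕ G))
      ≡⟨ cong (λ d → homogeneous t y d (subsetCount isMatchingℕ (edgesℕ G))) (edgeCount G) ⟩
    homogeneous t y (matchingCoeff G 1) (subsetCount isMatchingℕ (edgesℕ G))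
      ≡⟨ homogeneous-cong t y (matchingCoeff G 1) (λ k → sym (matchingCoeff-edgesℕ G k)) ⟩
    homogeneous t y (matchingCoeff G 1) (matchingCoeff G) ∎
    where open ≡-Reasoning

  matchingWeight-≡ᴹ : ∀ {G H} → G ≡ᴹ H → matchingWeight G ≡ matchingWeight H
  matchingWeight-≡ᴹ {G} {H} G≡ᴹH = begin
    matchingWeight G
      ≡⟨ matchingWeight-homogeneous G ⟩
    homogeneous t y (matchingCoeff G 1) (matchingCoeff G)
      ≡⟨ cong (λ d → homogeneous t y d (matchingCoeff G)) (G≡ᴹH 1) ⟩
    homogeneous t y (matchingCoeff H 1) (matchingCoeff G)
      ≡⟨ homogeneous-cong t y (matchingCoeff H 1) G≡ᴹH ⟩
    homogeneous t y (matchingCoeff H 1) (matchingCoeff H)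
      ≡⟨ matchingWeight-homogeneous H ⟨
    matchingWeight H ∎
    where open ≡-Reasoning

isEdge : (G : Graph) → Fin (n G) → Fin (n G) → Bool
isEdge G i j = (toℕ i <ᵇ toℕ j) ∧ adj G i j

row : (G : Graph) → Fin (n G) → List Edge
row G i = map (λ j → toℕ i , toℕ j) (filterᵇ (isEdge G i) (allFin (n G)))

edgesℕ-rows : ∀ G → edgesℕ G ≡ concatMap (row G) (allFin (n G))
edgesℕ-rows G = trans (List.map-concatMap toℕ² _ (allFin (n G)))
  (List.concatMap-cong (λ i → sym (List.map-∘ (filterᵇ (isEdge G i) (allFin (n G))))) (allFin (n G)))

tabulate-+ : ∀ m k (f : Fin (m ℕ.+ k) → A) →
  tabulate f ≡ tabulate (f ∘ (_↑ˡ k)) ++ tabulate (f ∘ (m ↑ʳ_))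
tabulate-+ zero    k f = refl
tabulate-+ (suc m) k f = cong (f Fin.zero ∷_) (tabulate-+ m k (f ∘ Fin.suc))

allFin-+ : ∀ m k → allFin (m ℕ.+ k) ≡ map (_↑ˡ k) (allFin m) ++ map (m ↑ʳ_) (allFin k)
allFin-+ m k = trans (tabulate-+ m k (λ i → i))
  (sym (cong₂ _++_ (List.map-tabulate (λ i → i) (_↑ˡ k)) (List.map-tabulate (λ i → i) (m ↑ʳ_))))

filterᵇ-allFin-+ : ∀ m k (p : Fin (m ℕ.+ k) → Bool) → filterᵇ p (allFin (m ℕ.+ k)) ≡
  map (_↑ˡ k) (filterᵇ (p ∘ (_↑ˡ k)) (allFin m)) ++ map (m ↑ʳ_) (filterᵇ (p ∘ (m ↑ʳ_)) (allFin k))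
filterᵇ-allFin-+ m k p rewrite allFin-+ m k =
  trans (List.filter-++ (T? ∘ p) (map (_↑ˡ k) (allFin m)) (map (m ↑ʳ_) (allFin k)))
        (cong₂ _++_ (filterᵇ-map p (_↑ˡ k) (allFin m)) (filterᵇ-map p (m ↑ʳ_) (allFin k)))

shift : ℕ → Edge → Edge
shift m (a , b) = m ℕ.+ a , m ℕ.+ b

<ᵇ-shift : ∀ m a b → (m ℕ.+ a <ᵇ m ℕ.+ b) ≡ (a <ᵇ b)
<ᵇ-shift zero    a b = refl
<ᵇ-shift (suc m) a b = <ᵇ-shift m a b

≡ᵇ-shift : ∀ m a b → (m ℕ.+ a ≡ᵇ m ℕ.+ b) ≡ (a ≡ᵇ b)
≡ᵇ-shift zero    a b = refl
≡ᵇ-shift (suc m) a b = ≡ᵇ-shift m a b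

module _ (G H : Graph) where
  private
    m k : ℕ
    m = n G
    k = n H

  isEdge-⊕ˡˡ : ∀ a b → isEdge (G ⊕ H) (a ↑ˡ k) (b ↑ˡ k) ≡ isEdge G a b
  isEdge-⊕ˡˡ a b
    rewrite Fin.toℕ-↑ˡ a k | Fin.toℕ-↑ˡ b k | Fin.splitAt-↑ˡ m a k | Fin.splitAt-↑ˡ m b k = refl

  isEdge-⊕ˡʳ : ∀ a b → isEdge (G ⊕ H) (a ↑ˡ k) (m ↑ʳ b) ≡ false
  isEdge-⊕ˡʳ a b rewrite Fin.splitAt-↑ˡ m a k | Fin.splitAt-↑ʳ m k b = ∧-zeroʳ _

  isEdge-⊕ʳˡ : ∀ a b → isEdge (G ⊕ H) (m ↑ʳ a) (b ↑ˡ k) ≡ false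
  isEdge-⊕ʳˡ a b rewrite Fin.splitAt-↑ʳ m k a | Fin.splitAt-↑ˡ m b k = ∧-zeroʳ _

  isEdge-⊕ʳʳ : ∀ a b → isEdge (G ⊕ H) (m ↑ʳ a) (m ↑ʳ b) ≡ isEdge H a b
  isEdge-⊕ʳʳ a b rewrite Fin.toℕ-↑ʳ m a | Fin.toℕ-↑ʳ m b | Fin.splitAt-↑ʳ m k a | Fin.splitAt-↑ʳ m k b
                       | <ᵇ-shift m (toℕ a) (toℕ b) = refl

  row-⊕ˡ : ∀ a → row (G ⊕ H) (a ↑ˡ k) ≡ row G a
  row-⊕ˡ a rewrite filterᵇ-allFin-+ m k (isEdge (G ⊕ H) (a ↑ˡ k))
                 | filterᵇ-cong {p = isEdge (G ⊕ H) (a ↑ˡ k) ∘ (_↑ˡ k)} (allFin m) (isEdge-⊕ˡˡ a)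
                 | filterᵇ-false (isEdge (G ⊕ H) (a ↑ˡ k) ∘ (m ↑ʳ_)) (allFin k) (isEdge-⊕ˡʳ a)
                 | List.++-identityʳ (map (_↑ˡ k) (filterᵇ (isEdge G a) (allFin m))) =
    trans (sym (List.map-∘ _)) (List.map-cong (λ j → cong₂ _,_ (Fin.toℕ-↑ˡ a k) (Fin.toℕ-↑ˡ j k)) _)

  row-⊕ʳ : ∀ a → row (G ⊕ H) (m ↑ʳ a) ≡ map (shift m) (row H a)
  row-⊕ʳ a rewrite filterᵇ-allFin-+ m k (isEdge (G ⊕ H) (m ↑ʳ a))
                 | filterᵇ-false (isEdge (G ⊕ H) (m ↑ʳ a) ∘ (_↑ˡ k)) (allFin m) (isEdge-⊕ʳˡ a)
                 | filterᵇ-cong {p = isEdge (G ⊕ H) (m ↑ʳ a) ∘ (m ↑ʳ_)} (allFin k) (isEdge-⊕ʳʳ a) =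
    trans (sym (List.map-∘ _))
          (trans (List.map-cong (λ j → cong₂ _,_ (Fin.toℕ-↑ʳ m a) (Fin.toℕ-↑ʳ m j)) _) (List.map-∘ _))

  edgesℕ-⊕ : edgesℕ (G ⊕ H) ≡ edgesℕ G ++ map (shift m) (edgesℕ H)
  edgesℕ-⊕ = begin
    edgesℕ (G ⊕ H)
      ≡⟨ edgesℕ-rows (G ⊕ H) ⟩
    concatMap (row (G ⊕ H)) (allFin (m ℕ.+ k))
      ≡⟨ cong (concatMap (row (G ⊕ H))) (allFin-+ m k) ⟩
    concatMap (row (G ⊕ H)) (map (_↑ˡ k) (allFin m) ++ map (m ↑ʳ_) (allFin k))
      ≡⟨ List.concatMap-++ (row (G ⊕ H)) (map (_↑ˡ k) (allFin m)) (map (m ↑ʳ_) (allFin k)) ⟩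
    concatMap (row (G ⊕ H)) (map (_↑ˡ k) (allFin m)) ++ concatMap (row (G ⊕ H)) (map (m ↑ʳ_) (allFin k))
      ≡⟨ cong₂ _++_ (trans (List.concatMap-map (row (G ⊕ H)) (_↑ˡ k) (allFin m))
                           (List.concatMap-cong row-⊕ˡ (allFin m)))
                    (trans (List.concatMap-map (row (G ⊕ H)) (m ↑ʳ_) (allFin k))
                           (List.concatMap-cong row-⊕ʳ (allFin k))) ⟩
    concatMap (row G) (allFin m) ++ concatMap (map (shift m) ∘ row H) (allFin k)
      ≡⟨ cong₂ _++_ (edgesℕ-rows G) (trans (cong (map (shift m)) (edgesℕ-rows H))
                                           (List.map-concatMap (shift m) (row H) (allFin k))) ⟨
    edgesℕ G ++ map (shift m) (edgesℕ H) ∎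
    where open ≡-Reasoning

≡ᵇ-false : ∀ {a c} → a ≢ c → (a ≡ᵇ c) ≡ false
≡ᵇ-false {a} {c} a≢c with a ≡ᵇ c in eq
... | true  = ⊥-elim (a≢c (ℕ.≡ᵇ⇒≡ a c (≡true⇒T eq)))
... | false = refl

Below AtLeast : ℕ → Edge → Set
Below   m (a , b) = a < m × b < m
AtLeast m (a , b) = m ≤ a × m ≤ b

disjointℕ-apart : ∀ {m e f} → Below m e → AtLeast m f → disjointℕ e f ≡ true
disjointℕ-apart {e = a , b} {c , d} (a<m , b<m) (m≤c , m≤d)
  rewrite ≡ᵇ-false (ℕ.<⇒≢ (ℕ.<-≤-trans a<m m≤c)) | ≡ᵇ-false (ℕ.<⇒≢ (ℕ.<-≤-trans a<m m≤d))
        | ≡ᵇ-false (ℕ.<⇒≢ (ℕ.<-≤-trans b<m m≤c)) | ≡ᵇ-false (ℕ.<⇒≢ (ℕ.<-≤-trans b<m m≤d)) = refl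

disjointℕ-shift : ∀ m e f → disjointℕ (shift m e) (shift m f) ≡ disjointℕ e f
disjointℕ-shift m (a , b) (c , d)
  rewrite ≡ᵇ-shift m a c | ≡ᵇ-shift m a d | ≡ᵇ-shift m b c | ≡ᵇ-shift m b d = refl

edgesℕ-below : ∀ G → All (Below (n G)) (edgesℕ G)
edgesℕ-below G = All.map⁺ (All.universal (λ { (a , b) → Fin.toℕ<n a , Fin.toℕ<n b }) (edges G))

shift-atLeast : ∀ m E → All (AtLeast m) (map (shift m) E)
shift-atLeast m E = All.map⁺ (All.universal (λ { (a , b) → ℕ.m≤m+n m a , ℕ.m≤m+n m b }) E)

module _ (t y : ℤ) where

  matchingWeightᴱ-shift : ∀ m E → matchingWeightᴱ t y (map (shift m) E) ≡ matchingWeightᴱ t y E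
  matchingWeightᴱ-shift m E =
    trans (subsetWeight-map t y isMatchingℕ (shift m) E) (subsetWeight-≗ t y E (pairwise-map (disjointℕ-shift m)))

  matchingWeight-⊕ : ∀ G H → matchingWeight t y (G ⊕ H) ≡ matchingWeight t y G * matchingWeight t y H
  matchingWeight-⊕ G H rewrite edgesℕ-⊕ G H =
    trans (subsetWeight-++ t y (edgesℕ-below G) (shift-atLeast (n G) (edgesℕ H))
                           (λ _ _ → pairwise-++ disjointℕ-apart))
          (cong (matchingWeight t y G *_) (matchingWeightᴱ-shift (n G) (edgesℕ H)))

edgeCount-⊕ : ∀ G H → length (edgesℕ (G ⊕ H)) ≡ length (edgesℕ G) ℕ.+ length (edgesℕ H)
edgeCount-⊕ G H rewrite edgesℕ-⊕ G H =
  trans (List.length-++ (edgesℕ G)) (cong (length (edgesℕ G) ℕ.+_) (List.length-map (shift (n G)) (edgesℕ H)))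

pathEdges : ℕ → List Edge
pathEdges zero    = []
pathEdges (suc r) = (0 , 1) ∷ map (shift 1) (pathEdges r)

tabulate-suc : ∀ k → tabulate {n = k} Fin.suc ≡ map Fin.suc (allFin k)
tabulate-suc k = sym (List.map-tabulate (λ i → i) Fin.suc)

row-P-suc : ∀ k i → row (P (suc k)) (Fin.suc i) ≡ map (shift 1) (row (P k) i)
row-P-suc k i rewrite tabulate-suc k | filterᵇ-map (isEdge (P (suc k)) (Fin.suc i)) Fin.suc (allFin k) =
  trans (sym (List.map-∘ _)) (List.map-∘ _)

row-P-zero : ∀ r → row (P (2 ℕ.+ r)) Fin.zero ≡ (0 , 1) ∷ []
row-P-zero r = cong (λ js → (0 , 1) ∷ map (λ j → 0 , toℕ j) js) (begin
  filterᵇ p (tabulate (Fin.suc ∘ Fin.suc))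
    ≡⟨ cong (filterᵇ p) (List.map-tabulate (λ i → i) (Fin.suc ∘ Fin.suc)) ⟨
  filterᵇ p (map (Fin.suc ∘ Fin.suc) (allFin r))
    ≡⟨ filterᵇ-map p (Fin.suc ∘ Fin.suc) (allFin r) ⟩
  map (Fin.suc ∘ Fin.suc) (filterᵇ (p ∘ Fin.suc ∘ Fin.suc) (allFin r))
    ≡⟨ cong (map (Fin.suc ∘ Fin.suc)) (filterᵇ-false _ (allFin r) (λ _ → refl)) ⟩
  [] ∎)
  where
  open ≡-Reasoning
  p = isEdge (P (2 ℕ.+ r)) Fin.zero

edgesℕ-P-suc : ∀ k → edgesℕ (P (suc k)) ≡ row (P (suc k)) Fin.zero ++ map (shift 1) (edgesℕ (P k))
edgesℕ-P-suc k = begin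
  edgesℕ (P (suc k))
    ≡⟨ edgesℕ-rows (P (suc k)) ⟩
  concatMap (row (P (suc k))) (allFin (suc k))
    ≡⟨ cong (λ is → concatMap (row (P (suc k))) (Fin.zero ∷ is)) (tabulate-suc k) ⟩
  row (P (suc k)) Fin.zero ++ concatMap (row (P (suc k))) (map Fin.suc (allFin k))
    ≡⟨ cong (row (P (suc k)) Fin.zero ++_) (trans (List.concatMap-map _ Fin.suc (allFin k))
                                                  (List.concatMap-cong (row-P-suc k) (allFin k))) ⟩
  row (P (suc k)) Fin.zero ++ concatMap (map (shift 1) ∘ row (P k)) (allFin k)
    ≡⟨ cong (λ E → row (P (suc k)) Fin.zero ++ E)
            (trans (cong (map (shift 1)) (edgesℕ-rows (P k)))
                   (List.map-concatMap (shift 1) (row (P k)) (allFin k))) ⟨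
  row (P (suc k)) Fin.zero ++ map (shift 1) (edgesℕ (P k)) ∎
  where open ≡-Reasoning

edgesℕ-P : ∀ r → edgesℕ (P (suc r)) ≡ pathEdges r
edgesℕ-P zero    = refl
edgesℕ-P (suc r) =
  trans (edgesℕ-P-suc (suc r)) (cong₂ _++_ (row-P-zero r) (cong (map (shift 1)) (edgesℕ-P r)))

pathWeight : ℤ → ℤ → ℕ → ℤ
pathWeight t y 0             = 1ℤ
pathWeight t y 1             = t + y
pathWeight t y (suc (suc r)) = y * pathWeight t y (suc r) + t * y * pathWeight t y r

∏ : List ℤ → ℤ
∏ = foldr _*_ 1ℤ

module _ (t y : ℤ) where

  matchingWeightᴱ-pathEdges : ∀ r → matchingWeightᴱ t y (pathEdges r) ≡ pathWeight t y r
  matchingWeightᴱ-pathEdges 0             = refl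
  matchingWeightᴱ-pathEdges 1             = cong₂ _+_ (ℤ.*-identityʳ t) (ℤ.*-identityʳ y)
  matchingWeightᴱ-pathEdges (suc (suc r)) = begin
    t * (t * W (λ S → isMatchingℕ ((0 , 1) ∷ (1 , 2) ∷ S)) E₂ + y * W (λ S → isMatchingℕ ((0 , 1) ∷ S)) E₂)
      + y * W isMatchingℕ ((1 , 2) ∷ E₂)
      ≡⟨ cong₂ (λ u v → t * (t * u + y * v) + y * W isMatchingℕ ((1 , 2) ∷ E₂))
               (subsetWeight-false t y (All.universal (λ _ → tt) E₂) (λ _ _ → refl))
               (subsetWeight-cong t y E₂-atLeast-2 (λ S S≥2 →
                  cong (_∧ isMatchingℕ S) (allᵇ-true (All.map (disjointℕ-apart (s≤s z≤n , s≤s (s≤s z≤n))) S≥2)))) ⟩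
    t * (t * 0ℤ + y * W isMatchingℕ E₂) + y * W isMatchingℕ ((1 , 2) ∷ E₂)
      ≡⟨ cong₂ (λ u v → t * (t * 0ℤ + y * u) + y * v)
               (trans (matchingWeightᴱ-shift t y 1 (map (shift 1) (pathEdges r)))
                      (trans (matchingWeightᴱ-shift t y 1 (pathEdges r)) (matchingWeightᴱ-pathEdges r)))
               (trans (matchingWeightᴱ-shift t y 1 (pathEdges (suc r))) (matchingWeightᴱ-pathEdges (suc r))) ⟩
    t * (t * 0ℤ + y * pathWeight t y r) + y * pathWeight t y (suc r)
      ≡⟨ ring t y (pathWeight t y r) (pathWeight t y (suc r)) ⟩
    y * pathWeight t y (suc r) + t * y * pathWeight t y r ∎
    where
    open ≡-Reasoning
    W = subsetWeight t y
    E₂ = map (shift 1) (map (shift 1) (pathEdges r))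
    E₂-atLeast-2 : All (AtLeast 2) E₂
    E₂-atLeast-2 = subst (All (AtLeast 2)) (List.map-∘ (pathEdges r)) (shift-atLeast 2 (pathEdges r))
    ring : ∀ t y a b → t * (t * 0ℤ + y * a) + y * b ≡ y * b + t * y * a
    ring = solve-∀

  matchingWeight-pathUnion : ∀ ℓs → All (1 ≤_) ℓs →
    matchingWeight t y (pathUnion ℓs) ≡ ∏ (map (pathWeight t y ∘ pred) ℓs)
  matchingWeight-pathUnion []           []      = refl
  matchingWeight-pathUnion (suc r ∷ ℓs) (_ ∷ ℓs≥1) =
    trans (matchingWeight-⊕ t y (P (suc r)) (pathUnion ℓs))
          (cong₂ _*_ (trans (cong (matchingWeightᴱ t y) (edgesℕ-P r)) (matchingWeightᴱ-pathEdges r))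
                     (matchingWeight-pathUnion ℓs ℓs≥1))

length-pathEdges : ∀ r → length (pathEdges r) ≡ r
length-pathEdges zero    = refl
length-pathEdges (suc r) = cong suc (trans (List.length-map (shift 1) (pathEdges r)) (length-pathEdges r))

edgeCount-pathUnion : ∀ ℓs → All (1 ≤_) ℓs → length (edgesℕ (pathUnion ℓs)) ≡ sum (map pred ℓs)
edgeCount-pathUnion []           []         = refl
edgeCount-pathUnion (suc r ∷ ℓs) (_ ∷ ℓs≥1) =
  trans (edgeCount-⊕ (P (suc r)) (pathUnion ℓs))
        (cong₂ ℕ._+_ (trans (cong length (edgesℕ-P r)) (length-pathEdges r)) (edgeCount-pathUnion ℓs ℓs≥1))

module _ {k : ℕ} where

  =ᶠ⇒≡ : ∀ (a b : Fin k) → (a =ᶠ b) ≡ true → a ≡ b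
  =ᶠ⇒≡ a b a=b = Fin.toℕ-injective (ℕ.≡ᵇ⇒≡ (toℕ a) (toℕ b) (≡true⇒T a=b))

  ≡⇒=ᶠ : ∀ {a b : Fin k} → a ≡ b → (a =ᶠ b) ≡ true
  ≡⇒=ᶠ {a} refl = T⇒≡true (ℕ.≡⇒≡ᵇ (toℕ a) (toℕ a) refl)

  =ᶠ-comm : ∀ (a b : Fin k) → (a =ᶠ b) ≡ (b =ᶠ a)
  =ᶠ-comm a b = Bool-ext (λ a=b → ≡⇒=ᶠ (sym (=ᶠ⇒≡ a b a=b))) (λ b=a → ≡⇒=ᶠ (sym (=ᶠ⇒≡ b a b=a)))

=ᶠ-injective : ∀ {k l} {g : Fin k → Fin l} → Injective _≡_ _≡_ g → ∀ a b → (g a =ᶠ g b) ≡ (a =ᶠ b)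
=ᶠ-injective {g = g} g-inj a b =
  Bool-ext (λ ga=gb → ≡⇒=ᶠ (g-inj (=ᶠ⇒≡ (g a) (g b) ga=gb))) (λ a=b → ≡⇒=ᶠ (cong g (=ᶠ⇒≡ a b a=b)))

module _ {k : ℕ} where

  disjointEdges-comm : ∀ (e f : Fin k × Fin k) → disjointEdges e f ≡ disjointEdges f e
  disjointEdges-comm (a , b) (c , d)
    rewrite =ᶠ-comm c a | =ᶠ-comm c b | =ᶠ-comm d a | =ᶠ-comm d b =
    cong (λ x → not ((a =ᶠ c) ∨ x)) (trans (sym (∨-assoc (a =ᶠ d) _ _))
      (trans (cong (_∨ (b =ᶠ d)) (∨-comm (a =ᶠ d) (b =ᶠ c))) (∨-assoc (b =ᶠ c) _ _)))

  disjointEdges-swap : ∀ (a b : Fin k) f → disjointEdges (b , a) f ≡ disjointEdges (a , b) f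
  disjointEdges-swap a b (c , d) =
    cong not (trans (sym (∨-assoc (b =ᶠ c) _ _))
      (trans (∨-comm ((b =ᶠ c) ∨ (b =ᶠ d)) _) (∨-assoc (a =ᶠ c) _ _)))

disjointEdges-injective : ∀ {k l} {g : Fin k → Fin l} → Injective _≡_ _≡_ g → ∀ a b c d →
  disjointEdges (g a , g b) (g c , g d) ≡ disjointEdges (a , b) (c , d)
disjointEdges-injective g-inj a b c d
  rewrite =ᶠ-injective g-inj a c | =ᶠ-injective g-inj a d
        | =ᶠ-injective g-inj b c | =ᶠ-injective g-inj b d = refl

<ᵇ-false : ∀ {m n} → n < m → (m <ᵇ n) ≡ false
<ᵇ-false {m} {n} n<m with m <ᵇ n in m<n
... | true  = ⊥-elim (ℕ.<-asym n<m (ℕ.<ᵇ⇒< m n (≡true⇒T m<n)))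
... | false = refl

orient : ∀ {k} → Fin k × Fin k → Fin k × Fin k
orient (a , b) = if toℕ a <ᵇ toℕ b then (a , b) else (b , a)

module _ {k : ℕ} where

  orient-< : ∀ {a b : Fin k} → toℕ a < toℕ b → orient (a , b) ≡ (a , b)
  orient-< a<b rewrite T⇒≡true (ℕ.<⇒<ᵇ a<b) = refl

  orient-> : ∀ {a b : Fin k} → toℕ b < toℕ a → orient (a , b) ≡ (b , a)
  orient-> b<a rewrite <ᵇ-false b<a = refl

  orient-swap : ∀ (a b : Fin k) → orient (b , a) ≡ orient (a , b)
  orient-swap a b with ℕ.<-cmp (toℕ a) (toℕ b)
  ... | tri< a<b _ _ = trans (orient-> a<b) (sym (orient-< a<b))
  ... | tri≈ _ a≡b _ rewrite Fin.toℕ-injective a≡b = refl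
  ... | tri> _ _ b<a = trans (orient-< b<a) (sym (orient-> b<a))

  disjointEdges-orient : ∀ (e f : Fin k × Fin k) → disjointEdges (orient e) f ≡ disjointEdges e f
  disjointEdges-orient (a , b) f with toℕ a <ᵇ toℕ b
  ... | true  = refl
  ... | false = disjointEdges-swap a b f

isMatching-↭ : ∀ {k} {S S′ : List (Fin k × Fin k)} → S ↭ S′ → isMatching S ≡ isMatching S′
isMatching-↭ {S = S} {S′} S↭S′ =
  trans (isMatching-pairwise S) (trans (pairwise-↭ disjointEdges-comm S↭S′) (sym (isMatching-pairwise S′)))

relabel : ∀ {k l} → (Fin k → Fin l) → Fin k × Fin k → Fin l × Fin l
relabel g (a , b) = orient (g a , g b)

relabel-orient : ∀ {k l} (g : Fin k → Fin l) e → relabel g (orient e) ≡ relabel g e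
relabel-orient g (a , b) with toℕ a <ᵇ toℕ b
... | true  = refl
... | false = orient-swap (g a) (g b)

disjointEdges-relabel : ∀ {k l} {g : Fin k → Fin l} → Injective _≡_ _≡_ g → ∀ e f →
  disjointEdges (relabel g e) (relabel g f) ≡ disjointEdges e f
disjointEdges-relabel {g = g} g-inj (a , b) (c , d) = begin
  disjointEdges (orient (g a , g b)) (orient (g c , g d)) ≡⟨ disjointEdges-orient (g a , g b) _ ⟩
  disjointEdges (g a , g b) (orient (g c , g d))          ≡⟨ disjointEdges-comm (g a , g b) _ ⟩
  disjointEdges (orient (g c , g d)) (g a , g b)          ≡⟨ disjointEdges-orient (g c , g d) _ ⟩
  disjointEdges (g c , g d) (g a , g b)                   ≡⟨ disjointEdges-comm (g c , g d) _ ⟩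
  disjointEdges (g a , g b) (g c , g d)                   ≡⟨ disjointEdges-injective g-inj a b c d ⟩
  disjointEdges (a , b) (c , d) ∎
  where open ≡-Reasoning

isMatching-relabel : ∀ {k l} {g : Fin k → Fin l} → Injective _≡_ _≡_ g → ∀ S →
  isMatching (map (relabel g) S) ≡ isMatching S
isMatching-relabel {g = g} g-inj S = trans (isMatching-pairwise (map (relabel g) S))
  (trans (pairwise-map (disjointEdges-relabel g-inj) S) (sym (isMatching-pairwise S)))

module _ (G : Graph) where

  edges-filter : edges G ≡ filterᵇ (uncurry (isEdge G)) (cartesianProduct (allFin (n G)) (allFin (n G)))
  edges-filter = go (allFin (n G))
    where
    go : ∀ is → concatMap (λ i → map (i ,_) (filterᵇ (isEdge G i) (allFin (n G)))) is ≡
                filterᵇ (uncurry (isEdge G)) (cartesianProduct is (allFin (n G)))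
    go []       = refl
    go (i ∷ is) =
      trans (cong₂ _++_ (sym (filterᵇ-map (uncurry (isEdge G)) (i ,_) (allFin (n G)))) (go is))
            (sym (List.filter-++ (T? ∘ uncurry (isEdge G)) (map (i ,_) (allFin (n G))) _))

  edges-unique : Unique (edges G)
  edges-unique rewrite edges-filter =
    Unique.filter⁺ (T? ∘ uncurry (isEdge G))
                   (Unique.cartesianProduct⁺ (Unique.allFin⁺ (n G)) (Unique.allFin⁺ (n G)))

  ∈-edges⁺ : ∀ {i j} → isEdge G i j ≡ true → (i , j) ∈ edges G
  ∈-edges⁺ {i} {j} ij-edge rewrite edges-filter =
    ∈.∈-filter⁺ (T? ∘ uncurry (isEdge G)) (∈.∈-cartesianProduct⁺ (∈.∈-allFin i) (∈.∈-allFin j)) (≡true⇒T ij-edge)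

  ∈-edges⁻ : ∀ {i j} → (i , j) ∈ edges G → isEdge G i j ≡ true
  ∈-edges⁻ ij∈E rewrite edges-filter =
    T⇒≡true (proj₂ (∈.∈-filter⁻ (T? ∘ uncurry (isEdge G))
                                 {xs = cartesianProduct (allFin (n G)) (allFin (n G))} ij∈E))

  isEdge-orient : ∀ {i j} → adj G i j ≡ true → uncurry (isEdge G) (orient (i , j)) ≡ true
  isEdge-orient {i} {j} ij-adj with ℕ.<-cmp (toℕ i) (toℕ j)
  ... | tri< i<j _ _ rewrite orient-< i<j | T⇒≡true (ℕ.<⇒<ᵇ i<j) = ij-adj
  ... | tri> _ _ j<i rewrite orient-> j<i | T⇒≡true (ℕ.<⇒<ᵇ j<i) = trans (adj-sym G j i) ij-adj
  ... | tri≈ _ i≡j _ rewrite Fin.toℕ-injective i≡j with () ← trans (sym ij-adj) (irrefl G j)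

  orient-edge : ∀ {i j} → isEdge G i j ≡ true → orient (i , j) ≡ (i , j)
  orient-edge {i} {j} ij-edge = orient-< (ℕ.<ᵇ⇒< (toℕ i) (toℕ j) (≡true⇒T (∧-true₁ ij-edge)))

module _ {G H : Graph} (f : Fin (n G) ↔ Fin (n H))
         (f-adj : ∀ i j → adj G i j ≡ adj H (Inverse.to f i) (Inverse.to f j)) where
  open Inverse f using (to; from; strictlyInverseˡ; strictlyInverseʳ)

  private
    to-injective : Injective _≡_ _≡_ to
    to-injective = Injection.injective (↔⇒↣ f)

    relabel-∈-edges : ∀ {i j} → (i , j) ∈ edges G → relabel to (i , j) ∈ edges H
    relabel-∈-edges {i} {j} ij∈E =
      ∈-edges⁺ H (isEdge-orient H (trans (sym (f-adj i j)) (∧-true₂ (∈-edges⁻ G ij∈E))))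

    from-adj : ∀ u v → adj H u v ≡ adj G (from u) (from v)
    from-adj u v = sym (trans (f-adj (from u) (from v)) (cong₂ (adj H) (strictlyInverseˡ u) (strictlyInverseˡ v)))

    relabel-from-to : ∀ {i j} → (i , j) ∈ edges G → relabel from (relabel to (i , j)) ≡ (i , j)
    relabel-from-to {i} {j} ij∈E = begin
      relabel from (orient (to i , to j))
        ≡⟨ relabel-orient from (to i , to j) ⟩
      orient (from (to i) , from (to j))
        ≡⟨ cong₂ (λ a b → orient (a , b)) (strictlyInverseʳ i) (strictlyInverseʳ j) ⟩
      orient (i , j)
        ≡⟨ orient-edge G (∈-edges⁻ G ij∈E) ⟩
      (i , j) ∎
      where open ≡-Reasoning

    ∈-relabelled⁺ : ∀ {e} → e ∈ edges H → e ∈ map (relabel to) (edges G)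
    ∈-relabelled⁺ {u , v} uv∈E = subst (_∈ map (relabel to) (edges G)) relabel≡ (∈.∈-map⁺ (relabel to) e∈E)
      where
      e = orient (from u , from v)
      e∈E : e ∈ edges G
      e∈E = ∈-edges⁺ G (isEdge-orient G (trans (sym (from-adj u v)) (∧-true₂ (∈-edges⁻ H uv∈E))))
      relabel≡ : relabel to e ≡ (u , v)
      relabel≡ = begin
        relabel to (orient (from u , from v))
          ≡⟨ relabel-orient to (from u , from v) ⟩
        orient (to (from u) , to (from v))
          ≡⟨ cong₂ (λ a b → orient (a , b)) (strictlyInverseˡ u) (strictlyInverseˡ v) ⟩
        orient (u , v)
          ≡⟨ orient-edge H (∈-edges⁻ H uv∈E) ⟩
        (u , v) ∎
        where open ≡-Reasoning

    ∈-relabelled⁻ : ∀ {e} → e ∈ map (relabel to) (edges G) → e ∈ edges H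
    ∈-relabelled⁻ e∈ with ∈.∈-map⁻ (relabel to) e∈
    ... | (i , j) , ij∈E , refl = relabel-∈-edges ij∈E

    relabelled-unique : Unique (map (relabel to) (edges G))
    relabelled-unique = Unique.map⁻ {f = relabel from} (subst Unique (sym from-to) (edges-unique G))
      where
      from-to : map (relabel from) (map (relabel to) (edges G)) ≡ edges G
      from-to = trans (sym (List.map-∘ (edges G))) (List.map-id-local (All.tabulate λ { {i , j} → relabel-from-to }))

  edges-↭-relabel : edges H ↭ map (relabel to) (edges G)
  edges-↭-relabel =
    ∼bag⇒↭ (unique∧set⇒bag (edges-unique H) relabelled-unique (mk⇔ ∈-relabelled⁺ ∈-relabelled⁻))

  matchingCoeff-relabel : ∀ k → matchingCoeff H k ≡ matchingCoeff G k
  matchingCoeff-relabel k = begin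
    count q (subsets (edges H))
      ≡⟨ count-subsets-↭ edges-↭-relabel q (λ S↭S′ →
           cong₂ _∧_ (cong (_≡ᵇ k) (↭.↭-length S↭S′)) (isMatching-↭ S↭S′)) ⟩
    count q (subsets (map (relabel to) (edges G)))
      ≡⟨ cong (count q) (subsets-map (relabel to) (edges G)) ⟩
    count q (map (map (relabel to)) (subsets (edges G)))
      ≡⟨ count-map q (map (relabel to)) (subsets (edges G)) ⟩
    count (q ∘ map (relabel to)) (subsets (edges G))
      ≡⟨ count-cong (subsets (edges G)) (λ S →
           cong₂ _∧_ (cong (_≡ᵇ k) (List.length-map (relabel to) S)) (isMatching-relabel to-injective S)) ⟩
    count q (subsets (edges G)) ∎
    where
    open ≡-Reasoning
    q : ∀ {l} → List (Fin l × Fin l) → Bool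
    q S = (length S ≡ᵇ k) ∧ isMatching S

matchingCoeff-≅ : ∀ {G H} → G ≅ H → G ≡ᴹ H
matchingCoeff-≅ {G} {H} (f , f-adj) k = sym (matchingCoeff-relabel {G} {H} f f-adj k)

-- Unlike _≅_, this record determines the two graphs, so isomorphisms compose without annotations.
record _≃_ (G H : Graph) : Set where
  constructor mk≃
  field iso : G ≅ H

≃-refl : ∀ {G} → G ≃ G
≃-refl = mk≃ (↔-refl , λ _ _ → refl)

≃-sym : ∀ {G H} → G ≃ H → H ≃ G
≃-sym {G} {H} (mk≃ (f , f-adj)) = mk≃ (↔-sym f , λ u v →
  sym (trans (f-adj (from u) (from v)) (cong₂ (adj H) (strictlyInverseˡ u) (strictlyInverseˡ v))))
  where open Inverse f

≃-trans : ∀ {G H K} → G ≃ H → H ≃ K → G ≃ K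
≃-trans (mk≃ (f , f-adj)) (mk≃ (g , g-adj)) =
  mk≃ (↔-trans f g , λ i j → trans (f-adj i j) (g-adj (Inverse.to f i) (Inverse.to f j)))

≃-setoid : Setoid _ _
≃-setoid = record
  { Carrier = Graph ; _≈_ = _≃_
  ; isEquivalence = record { refl = ≃-refl ; sym = ≃-sym ; trans = ≃-trans } }

vertexCount-≅ : ∀ {G H} → G ≅ H → n G ≡ n H
vertexCount-≅ (f , _) =
  Fin.cantor-schröder-bernstein (Injection.injective (↔⇒↣ f)) (Injection.injective (↔⇒↣ (↔-sym f)))

sumAdj : ∀ G H → Fin (n G) ⊎ Fin (n H) → Fin (n G) ⊎ Fin (n H) → Bool
sumAdj G H (inj₁ a) (inj₁ b) = adj G a b
sumAdj G H (inj₂ a) (inj₂ b) = adj H a b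
sumAdj G H (inj₁ _) (inj₂ _) = false
sumAdj G H (inj₂ _) (inj₁ _) = false

adj-⊕-splitAt : ∀ G H i j → adj (G ⊕ H) i j ≡ sumAdj G H (splitAt (n G) i) (splitAt (n G) j)
adj-⊕-splitAt G H i j with splitAt (n G) i | splitAt (n G) j
... | inj₁ a | inj₁ b = refl
... | inj₁ a | inj₂ b = refl
... | inj₂ a | inj₁ b = refl
... | inj₂ a | inj₂ b = refl

adj-⊕-join : ∀ G H x y → adj (G ⊕ H) (join (n G) (n H) x) (join (n G) (n H) y) ≡ sumAdj G H x y
adj-⊕-join G H x y =
  trans (adj-⊕-splitAt G H _ _)
        (cong₂ (sumAdj G H) (Fin.splitAt-join (n G) (n H) x) (Fin.splitAt-join (n G) (n H) y))

⊕-≃ : ∀ G H G′ H′ (σ : (Fin (n G) ⊎ Fin (n H)) ↔ (Fin (n G′) ⊎ Fin (n H′))) →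
      (∀ x y → sumAdj G H x y ≡ sumAdj G′ H′ (Inverse.to σ x) (Inverse.to σ y)) → (G ⊕ H) ≃ (G′ ⊕ H′)
⊕-≃ G H G′ H′ σ σ-adj = mk≃ (↔-trans Fin.+↔⊎ (↔-trans σ (↔-sym Fin.+↔⊎)) , λ i j →
  trans (adj-⊕-splitAt G H i j)
        (trans (σ-adj (splitAt (n G) i) (splitAt (n G) j))
               (sym (adj-⊕-join G′ H′ (Inverse.to σ (splitAt (n G) i)) (Inverse.to σ (splitAt (n G) j))))))

⊕-cong : ∀ {G G′ H H′} → G ≃ G′ → H ≃ H′ → (G ⊕ H) ≃ (G′ ⊕ H′)
⊕-cong {G} {G′} {H} {H′} (mk≃ (f , f-adj)) (mk≃ (g , g-adj)) = ⊕-≃ G H G′ H′ (⊎-cong f g) λ where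
  (inj₁ a) (inj₁ b) → f-adj a b
  (inj₁ a) (inj₂ b) → refl
  (inj₂ a) (inj₁ b) → refl
  (inj₂ a) (inj₂ b) → g-adj a b

⊕-comm : ∀ G H → (G ⊕ H) ≃ (H ⊕ G)
⊕-comm G H = ⊕-≃ G H H G (⊎-comm _ _) λ where
  (inj₁ a) (inj₁ b) → refl
  (inj₁ a) (inj₂ b) → refl
  (inj₂ a) (inj₁ b) → refl
  (inj₂ a) (inj₂ b) → refl

⊕-assoc : ∀ A B C → (A ⊕ (B ⊕ C)) ≃ ((A ⊕ B) ⊕ C)
⊕-assoc A B C = ⊕-≃ A (B ⊕ C) (A ⊕ B) C σ σ-adj
  where
  σ : (Fin (n A) ⊎ Fin (n B ℕ.+ n C)) ↔ (Fin (n A ℕ.+ n B) ⊎ Fin (n C))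
  σ = ↔-trans (⊎-cong ↔-refl Fin.+↔⊎) (↔-trans (↔-sym (⊎-assoc _ _ _ _)) (⊎-cong (↔-sym Fin.+↔⊎) ↔-refl))
  σ-adj : ∀ x y → sumAdj A (B ⊕ C) x y ≡ sumAdj (A ⊕ B) C (Inverse.to σ x) (Inverse.to σ y)
  σ-adj (inj₁ a) (inj₁ a′) = sym (adj-⊕-join A B (inj₁ a) (inj₁ a′))
  σ-adj (inj₁ a) (inj₂ w) with splitAt (n B) w
  ... | inj₁ b = sym (adj-⊕-join A B (inj₁ a) (inj₂ b))
  ... | inj₂ c = refl
  σ-adj (inj₂ w) (inj₁ a) with splitAt (n B) w
  ... | inj₁ b = sym (adj-⊕-join A B (inj₂ b) (inj₁ a))
  ... | inj₂ c = refl
  σ-adj (inj₂ w) (inj₂ w′) rewrite adj-⊕-splitAt B C w w′ with splitAt (n B) w | splitAt (n B) w′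
  ... | inj₁ b | inj₁ b′ = sym (adj-⊕-join A B (inj₂ b) (inj₂ b′))
  ... | inj₁ b | inj₂ c′ = refl
  ... | inj₂ c | inj₁ b′ = refl
  ... | inj₂ c | inj₂ c′ = refl

pathUnion-↭ : ∀ {ℓs ℓs′} → ℓs ↭ ℓs′ → pathUnion ℓs ≃ pathUnion ℓs′
pathUnion-↭ ↭.refl                  = ≃-refl
pathUnion-↭ (↭.prep ℓ ℓs↭ℓs′)       = ⊕-cong (≃-refl {P ℓ}) (pathUnion-↭ ℓs↭ℓs′)
pathUnion-↭ (↭.swap {ℓs} {ℓs′} x y ℓs↭ℓs′) = begin
  P x ⊕ (P y ⊕ pathUnion ℓs)   ≈⟨ ⊕-assoc (P x) (P y) (pathUnion ℓs) ⟩
  (P x ⊕ P y) ⊕ pathUnion ℓs   ≈⟨ ⊕-cong (⊕-comm (P x) (P y)) (≃-refl {pathUnion ℓs}) ⟩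
  (P y ⊕ P x) ⊕ pathUnion ℓs   ≈⟨ ⊕-assoc (P y) (P x) (pathUnion ℓs) ⟨
  P y ⊕ (P x ⊕ pathUnion ℓs)   ≈⟨ ⊕-cong (≃-refl {P y}) (⊕-cong (≃-refl {P x}) (pathUnion-↭ ℓs↭ℓs′)) ⟩
  P y ⊕ (P x ⊕ pathUnion ℓs′)  ∎
  where open import Relation.Binary.Reasoning.Setoid ≃-setoid
pathUnion-↭ (↭.trans ℓs↭ℓs′ ℓs′↭ℓs″) = ≃-trans (pathUnion-↭ ℓs↭ℓs′) (pathUnion-↭ ℓs′↭ℓs″)

oneMinusPowers : List ℕ → ℤ → ℤ
oneMinusPowers []      q = 1ℤ
oneMinusPowers (m ∷ S) q = (1ℤ - q ^ suc m) * oneMinusPowers S q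

oneMinusPowers-↭ : ∀ {S S′} → S ↭ S′ → ∀ q → oneMinusPowers S q ≡ oneMinusPowers S′ q
oneMinusPowers-↭ ↭.refl             q = refl
oneMinusPowers-↭ (↭.prep m S↭S′)    q = cong ((1ℤ - q ^ suc m) *_) (oneMinusPowers-↭ S↭S′ q)
oneMinusPowers-↭ (↭.swap m m′ S↭S′) q =
  trans (cong (λ B → (1ℤ - q ^ suc m) * ((1ℤ - q ^ suc m′) * B)) (oneMinusPowers-↭ S↭S′ q))
        (ring (1ℤ - q ^ suc m) (1ℤ - q ^ suc m′) _)
  where
  ring : ∀ a b c → a * (b * c) ≡ b * (a * c)
  ring = solve-∀
oneMinusPowers-↭ (↭.trans S↭S′ S′↭S″) q = trans (oneMinusPowers-↭ S↭S′ q) (oneMinusPowers-↭ S′↭S″ q)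

-- For S ⊆ [k, ∞), r is the number of occurrences of k in S.
Expansion : ℕ → List ℕ → ℕ → Set
Expansion k S r = Σ (ℤ → ℤ) λ R → ∀ q → oneMinusPowers S q ≡ 1ℤ - + r * q ^ suc k + q ^ suc (suc k) * R q

expansion : ∀ k S → All (k ≤_) S → Σ ℕ (Expansion k S)
expansion-head : ∀ k S → All (k ≤_) S → Σ ℕ (Expansion k (k ∷ S) ∘ suc)

expansion k []      []            = 0 , (λ _ → 0ℤ) , λ q → ring q (q ^ k)
  where
  ring : ∀ q a → 1ℤ ≡ 1ℤ - + 0 * (q * a) + q * (q * a) * 0ℤ
  ring = solve-∀
expansion k (s ∷ S) (k≤s ∷ k≤S) with ℕ.m≤n⇒∃[o]m+o≡n k≤s
... | zero  , refl rewrite ℕ.+-identityʳ k = let r , E = expansion-head k S k≤S in suc r , E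
... | suc d , refl with expansion k S k≤S
...   | r , R , e = r , R′ , λ q →
  trans (cong₂ _*_ (cong (_-_ 1ℤ) (ℤ.^-distribˡ-+-* q (suc k) (suc d))) (e q))
        (ring q (q ^ k) (q ^ d) (+ r) (R q))
  where
  R′ : ℤ → ℤ
  R′ q = R q - q ^ d + + r * q ^ k * (q * q ^ d) - (q * q ^ d) * (q * q ^ k) * R q
  ring : ∀ q a b r R → (1ℤ - (q * a) * (q * b)) * (1ℤ - r * (q * a) + q * (q * a) * R) ≡
                       1ℤ - r * (q * a) + q * (q * a) * (R - b + r * a * (q * b) - (q * b) * (q * a) * R)
  ring = solve-∀

expansion-head k S k≤S with expansion k S k≤S
... | r , R , e = r , R′ , λ q →
  trans (cong ((1ℤ - q ^ suc k) *_) (e q))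
        (trans (ring q (q ^ k) (+ r) (R q))
               (cong (λ c → 1ℤ - c * q ^ suc k + q ^ suc (suc k) * R′ q) (sym (ℤ.pos-+ 1 r))))
  where
  R′ : ℤ → ℤ
  R′ q = R q + + r * q ^ k - q * q ^ k * R q
  ring : ∀ q a r R → (1ℤ - q * a) * (1ℤ - r * (q * a) + q * (q * a) * R) ≡
                     1ℤ - (1ℤ + r) * (q * a) + q * (q * a) * (R + r * a - q * a * R)
  ring = solve-∀

point : ℕ → ℤ
point j = + (2 ℕ.+ j)

small-not-multiple : ∀ {a b} X → suc a < b → + suc a ≢ + b * X
small-not-multiple {a} {b} X a<b a≡bX = ℕ.<⇒≱ a<b
  (∣⇒≤ (divides ∣ X ∣ (trans (cong ∣_∣ a≡bX) (trans (ℤ.abs-* (+ b) X) (ℕ.*-comm b ∣ X ∣)))))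

point^-nonZero : ∀ j m → ℤ.NonZero (point j ^ m)
point^-nonZero j m = ℤ.≢-nonZero λ q^m≡0 → case ℤ.i^n≡0⇒i≡0 (point j) m q^m≡0 of λ ()

1-point^-nonZero : ∀ j m → ℤ.NonZero (1ℤ - point j ^ suc m)
1-point^-nonZero j m = ℤ.≢-nonZero λ 1-q^m≡0 →
  small-not-multiple {0} {2 ℕ.+ j} (point j ^ m) (s≤s (s≤s z≤n)) (ℤ.i-j≡0⇒i≡j 1ℤ (point j ^ suc m) 1-q^m≡0)

-- Evaluating at q = r + 2, the coefficient r + 1 of q ^ (k+1) on the left is not divisible by q.
head-differs : ∀ k S S′ → All (k ≤_) S → All (suc k ≤_) S′ →
  ¬ (∀ j → oneMinusPowers (k ∷ S) (point j) ≡ oneMinusPowers S′ (point j))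
head-differs k S S′ k≤S k<S′ B≡B′ with expansion-head k S k≤S | expansion (suc k) S′ k<S′
... | r , R , e | r′ , R′ , e′ =
  small-not-multiple {r} {2 ℕ.+ r} (R q + + r′ - q * R′ q) ℕ.≤-refl
    (ℤ.*-cancelʳ-≡ _ _ (q ^ suc k) {{point^-nonZero r (suc k)}}
      (coefficient q (q ^ k) (+ suc r) (R q) (+ r′) (R′ q) (trans (sym (e q)) (trans (B≡B′ r) (e′ q)))))
  where
  q = point r
  coefficient : ∀ q a s R r′ R′ →
    1ℤ - s * (q * a) + q * (q * a) * R ≡ 1ℤ - r′ * (q * (q * a)) + q * (q * (q * a)) * R′ →
    s * (q * a) ≡ (q * (R + r′ - q * R′)) * (q * a)
  coefficient q a s R r′ R′ eq =
    trans (ring₁ q a s R) (trans (cong (λ z → 1ℤ - z + q * (q * a) * R) eq) (ring₂ q a R r′ R′))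
    where
    ring₁ : ∀ q a s R → s * (q * a) ≡ 1ℤ - (1ℤ - s * (q * a) + q * (q * a) * R) + q * (q * a) * R
    ring₁ = solve-∀
    ring₂ : ∀ q a R r′ R′ → 1ℤ - (1ℤ - r′ * (q * (q * a)) + q * (q * (q * a)) * R′) + q * (q * a) * R ≡
                            (q * (R + r′ - q * R′)) * (q * a)
    ring₂ = solve-∀

oneMinusPowers-injective : ∀ {S S′} → AllPairs _≤_ S → AllPairs _≤_ S′ →
  (∀ j → oneMinusPowers S (point j) ≡ oneMinusPowers S′ (point j)) → S ≡ S′
oneMinusPowers-injective []            []              B≡B′ = refl
oneMinusPowers-injective []            (k≤S′ ∷ _)     B≡B′ = ⊥-elim (head-differs _ _ [] k≤S′ [] (sym ∘ B≡B′))
oneMinusPowers-injective (k≤S ∷ _)     []              B≡B′ = ⊥-elim (head-differs _ _ [] k≤S [] B≡B′)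
oneMinusPowers-injective {k ∷ S} {k′ ∷ S′} (k≤S ∷ S↗) (k′≤S′ ∷ S′↗) B≡B′ with ℕ.<-cmp k k′
... | tri< k<k′ _ _ = ⊥-elim (head-differs k S (k′ ∷ S′) k≤S (k<k′ ∷ All.map (ℕ.≤-trans k<k′) k′≤S′) B≡B′)
... | tri> _ _ k′<k = ⊥-elim (head-differs k′ S′ (k ∷ S) k′≤S′ (k′<k ∷ All.map (ℕ.≤-trans k′<k) k≤S) (sym ∘ B≡B′))
... | tri≈ _ refl _ = cong (k ∷_) (oneMinusPowers-injective S↗ S′↗ λ j →
  ℤ.*-cancelˡ-≡ (1ℤ - point j ^ suc k) _ _ {{1-point^-nonZero j k}} (B≡B′ j))

module _ (q : ℤ) where

  -- At t = -q, y = (1 + q)² the recurrence of pathWeight has characteristic roots 1 + q and q(1 + q).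
  pathWeight-closed : ∀ r → (1ℤ - q * q) * pathWeight (- q) ((1ℤ + q) * (1ℤ + q)) r ≡
                             (1ℤ + q) ^ r * (1ℤ - q ^ suc (suc r))
  pathWeight-closed 0 = ring q
    where
    ring : ∀ q → (1ℤ - q * q) * 1ℤ ≡ 1ℤ * (1ℤ - q * (q * 1ℤ))
    ring = solve-∀
  pathWeight-closed 1 = ring q
    where
    ring : ∀ q → (1ℤ - q * q) * (- q + (1ℤ + q) * (1ℤ + q)) ≡ (1ℤ + q) * 1ℤ * (1ℤ - q * (q * (q * 1ℤ)))
    ring = solve-∀
  pathWeight-closed (suc (suc r)) = begin
    (1ℤ - q * q) * (y * F (suc r) + - q * y * F r)
      ≡⟨ ring₁ q y (F (suc r)) (F r) ⟩
    y * ((1ℤ - q * q) * F (suc r)) + - q * y * ((1ℤ - q * q) * F r)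
      ≡⟨ cong₂ (λ u v → y * u + - q * y * v) (pathWeight-closed (suc r)) (pathWeight-closed r) ⟩
    y * ((1ℤ + q) * (1ℤ + q) ^ r * (1ℤ - q * q ^ suc (suc r))) + - q * y * ((1ℤ + q) ^ r * (1ℤ - q ^ suc (suc r)))
      ≡⟨ ring₂ q ((1ℤ + q) ^ r) (q ^ suc (suc r)) ⟩
    (1ℤ + q) * ((1ℤ + q) * (1ℤ + q) ^ r) * (1ℤ - q * (q * q ^ suc (suc r))) ∎
    where
    open ≡-Reasoning
    y = (1ℤ + q) * (1ℤ + q)
    F = pathWeight (- q) y
    ring₁ : ∀ q y a b → (1ℤ - q * q) * (y * a + - q * y * b) ≡ y * ((1ℤ - q * q) * a) + - q * y * ((1ℤ - q * q) * b)
    ring₁ = solve-∀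
    ring₂ : ∀ q P Z →
      (1ℤ + q) * (1ℤ + q) * ((1ℤ + q) * P * (1ℤ - q * Z)) + - q * ((1ℤ + q) * (1ℤ + q)) * (P * (1ℤ - Z)) ≡
      (1ℤ + q) * ((1ℤ + q) * P) * (1ℤ - q * (q * Z))
    ring₂ = solve-∀

  pathUnionWeight-closed : ∀ ℓs → All (1 ≤_) ℓs →
    (1ℤ - q * q) ^ length ℓs * ∏ (map (pathWeight (- q) ((1ℤ + q) * (1ℤ + q)) ∘ pred) ℓs) ≡
    (1ℤ + q) ^ sum (map pred ℓs) * oneMinusPowers ℓs q
  pathUnionWeight-closed []           []         = refl
  pathUnionWeight-closed (suc r ∷ ℓs) (_ ∷ ℓs≥1) = begin
    (1ℤ - q * q) * (1ℤ - q * q) ^ length ℓs * (F r * ∏ (map (F ∘ pred) ℓs))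
      ≡⟨ ring (1ℤ - q * q) ((1ℤ - q * q) ^ length ℓs) (F r) (∏ (map (F ∘ pred) ℓs)) ⟩
    ((1ℤ - q * q) * F r) * ((1ℤ - q * q) ^ length ℓs * ∏ (map (F ∘ pred) ℓs))
      ≡⟨ cong₂ _*_ (pathWeight-closed r) (pathUnionWeight-closed ℓs ℓs≥1) ⟩
    ((1ℤ + q) ^ r * (1ℤ - q ^ suc (suc r))) * ((1ℤ + q) ^ sum (map pred ℓs) * oneMinusPowers ℓs q)
      ≡⟨ ring ((1ℤ + q) ^ r) (1ℤ - q ^ suc (suc r)) ((1ℤ + q) ^ sum (map pred ℓs)) (oneMinusPowers ℓs q) ⟩
    ((1ℤ + q) ^ r * (1ℤ + q) ^ sum (map pred ℓs)) * ((1ℤ - q ^ suc (suc r)) * oneMinusPowers ℓs q)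
      ≡⟨ cong (_* ((1ℤ - q ^ suc (suc r)) * oneMinusPowers ℓs q))
              (ℤ.^-distribˡ-+-* (1ℤ + q) r (sum (map pred ℓs))) ⟨
    (1ℤ + q) ^ (r ℕ.+ sum (map pred ℓs)) * ((1ℤ - q ^ suc (suc r)) * oneMinusPowers ℓs q) ∎
    where
    open ≡-Reasoning
    F = pathWeight (- q) ((1ℤ + q) * (1ℤ + q))
    ring : ∀ a b c d → a * b * (c * d) ≡ (a * c) * (b * d)
    ring = solve-∀

sum-pred : ∀ ℓs → All (1 ≤_) ℓs → sum ℓs ≡ length ℓs ℕ.+ sum (map pred ℓs)
sum-pred []           []         = refl
sum-pred (suc r ∷ ℓs) (_ ∷ ℓs≥1) =
  cong suc (trans (cong (r ℕ.+_) (sum-pred ℓs ℓs≥1)) (+.x∙yz≈y∙xz r (length ℓs) _))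

vertexCount-pathUnion : ∀ ℓs → n (pathUnion ℓs) ≡ sum ℓs
vertexCount-pathUnion []       = refl
vertexCount-pathUnion (ℓ ∷ ℓs) = cong (ℓ ℕ.+_) (vertexCount-pathUnion ℓs)

oneMinusPowers-point⇒↭ : ∀ {ℓs ℓs′} →
  (∀ j → oneMinusPowers ℓs (point j) ≡ oneMinusPowers ℓs′ (point j)) → ℓs ↭ ℓs′
oneMinusPowers-point⇒↭ {ℓs} {ℓs′} B≡B′ = begin
  ℓs       ↭⟨ sort-↭ ℓs ⟨
  sort ℓs  ≡⟨ oneMinusPowers-injective (sorted ℓs) (sorted ℓs′) (λ j →
                trans (oneMinusPowers-↭ (sort-↭ ℓs) (point j))
                      (trans (B≡B′ j) (sym (oneMinusPowers-↭ (sort-↭ ℓs′) (point j))))) ⟩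
  sort ℓs′ ↭⟨ sort-↭ ℓs′ ⟩
  ℓs′      ∎
  where
  open ↭.PermutationReasoning
  sorted = λ xs → Linked⇒AllPairs ℕ.≤-trans (sort-↗ xs)

pathUnion-oneMinusPowers : ∀ {ℓs ℓs′} → All (1 ≤_) ℓs → All (1 ≤_) ℓs′ →
  length ℓs ≡ length ℓs′ → sum (map pred ℓs) ≡ sum (map pred ℓs′) → pathUnion ℓs ≡ᴹ pathUnion ℓs′ →
  ∀ j → oneMinusPowers ℓs (point j) ≡ oneMinusPowers ℓs′ (point j)
pathUnion-oneMinusPowers {ℓs} {ℓs′} ℓs≥1 ℓs′≥1 length≡ edges≡ M≡ j =
  ℤ.*-cancelˡ-≡ ((1ℤ + q) ^ sum (map pred ℓs)) _ _ {{point^-nonZero (suc j) (sum (map pred ℓs))}} (begin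
    (1ℤ + q) ^ sum (map pred ℓs) * oneMinusPowers ℓs q
      ≡⟨ pathUnionWeight-closed q ℓs ℓs≥1 ⟨
    (1ℤ - q * q) ^ length ℓs * ∏ (map (pathWeight t y ∘ pred) ℓs)
      ≡⟨ cong₂ (λ l w → (1ℤ - q * q) ^ l * w) length≡ weights≡ ⟩
    (1ℤ - q * q) ^ length ℓs′ * ∏ (map (pathWeight t y ∘ pred) ℓs′)
      ≡⟨ pathUnionWeight-closed q ℓs′ ℓs′≥1 ⟩
    (1ℤ + q) ^ sum (map pred ℓs′) * oneMinusPowers ℓs′ q
      ≡⟨ cong (λ e → (1ℤ + q) ^ e * oneMinusPowers ℓs′ q) edges≡ ⟨
    (1ℤ + q) ^ sum (map pred ℓs) * oneMinusPowers ℓs′ q ∎)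
  where
  open ≡-Reasoning
  q = point j
  t = - q
  y = (1ℤ + q) * (1ℤ + q)
  weights≡ : ∏ (map (pathWeight t y ∘ pred) ℓs) ≡ ∏ (map (pathWeight t y ∘ pred) ℓs′)
  weights≡ = begin
    ∏ (map (pathWeight t y ∘ pred) ℓs)  ≡⟨ matchingWeight-pathUnion t y ℓs ℓs≥1 ⟨
    matchingWeight t y (pathUnion ℓs)  ≡⟨ matchingWeight-≡ᴹ t y {pathUnion ℓs} {pathUnion ℓs′} M≡ ⟩
    matchingWeight t y (pathUnion ℓs′) ≡⟨ matchingWeight-pathUnion t y ℓs′ ℓs′≥1 ⟩
    ∏ (map (pathWeight t y ∘ pred) ℓs′) ∎

pathUnion-≡ᴹ⇒↭ : ∀ {ℓs ℓs′} → All (1 ≤_) ℓs → All (1 ≤_) ℓs′ → sum ℓs ≡ sum ℓs′ →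
  pathUnion ℓs ≡ᴹ pathUnion ℓs′ → ℓs ↭ ℓs′
pathUnion-≡ᴹ⇒↭ {ℓs} {ℓs′} ℓs≥1 ℓs′≥1 sum≡ M≡ =
  oneMinusPowers-point⇒↭ (pathUnion-oneMinusPowers ℓs≥1 ℓs′≥1 length≡ edges≡ M≡)
  where
  edges≡ : sum (map pred ℓs) ≡ sum (map pred ℓs′)
  edges≡ = trans (sym (edgeCount-pathUnion ℓs ℓs≥1)) (trans (edgeCount (pathUnion ℓs))
             (trans (M≡ 1) (trans (sym (edgeCount (pathUnion ℓs′))) (edgeCount-pathUnion ℓs′ ℓs′≥1))))
  length≡ : length ℓs ≡ length ℓs′
  length≡ = ℕ.+-cancelʳ-≡ _ (length ℓs) (length ℓs′)
    (trans (sym (sum-pred ℓs ℓs≥1))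
           (trans sum≡ (trans (sum-pred ℓs′ ℓs′≥1) (cong (length ℓs′ ℕ.+_) (sym edges≡)))))

proposition4p7 : (G H : Graph) → IsPathUnion G → IsPathUnion H →
    ∣ G ∣ᵥ ≡ ∣ H ∣ᵥ → G ≡ᴹ H → G ≅ H
proposition4p7 G H (ℓs , ℓs≥1 , G≅U) (ℓs′ , ℓs′≥1 , H≅U′) |G|≡|H| G≡ᴹH = _≃_.iso (begin
  G             ≈⟨ mk≃ G≅U ⟩
  pathUnion ℓs  ≈⟨ pathUnion-↭ (pathUnion-≡ᴹ⇒↭ ℓs≥1 ℓs′≥1 sum≡ U≡ᴹU′) ⟩
  pathUnion ℓs′ ≈⟨ mk≃ H≅U′ ⟨
  H             ∎)
  where
  open import Relation.Binary.Reasoning.Setoid ≃-setoid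
  sum≡ : sum ℓs ≡ sum ℓs′
  sum≡ = trans (sym (vertexCount-pathUnion ℓs)) (trans (sym (vertexCount-≅ {G} {pathUnion ℓs} G≅U))
           (trans |G|≡|H| (trans (vertexCount-≅ {H} {pathUnion ℓs′} H≅U′) (vertexCount-pathUnion ℓs′))))
  U≡ᴹU′ : pathUnion ℓs ≡ᴹ pathUnion ℓs′
  U≡ᴹU′ k = trans (sym (matchingCoeff-≅ {G} {pathUnion ℓs} G≅U k))
                  (trans (G≡ᴹH k) (matchingCoeff-≅ {H} {pathUnion ℓs′} H≅U′ k))
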